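{- Let $X$ be a finite set partitioned as $X = X_1 \cup X_2$ with $X_1 \neq \emptyset$ and $X_2 \neq \emptyset$. Let $\mathcal{F} \subseteq 2^X$ be a 1-part intersecting, 1-part Sperner set system of maximum size. Then $|\mathcal{F}| = 2^{|X|-2}$.
   Context: For $F \subseteq X$, the sets $F \cap X_1$ and $F \cap X_2$ are called the traces of $F$ on $X_1$ and $X_2$. A system $\mathcal{F} \subseteq 2^X$ is 1-part intersecting, 1-part Sperner if there is no pair of distinct sets $F_1, F_2 \in \mathcal{F}$ and index $i \in \{1,2\}$ (with $j$ the other index) such that the traces $F_1 \cap X_i$ and $F_2 \cap X_i$ are disjoint while the traces $F_1 \cap X_j$ and $F_2 \cap X_j$ are in containment, i.e. one of them is a subset (not necessarily proper) of the other. -}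

module Defs where

open import Data.Nat using (ℕ; _+_)
open import Data.Vec using (take; drop)
open import Data.Fin.Subset using (Subset; _⊆_; _∩_; Empty)
open import Data.List using (List)
open import Data.List.Membership.Propositional using (_∈_)
open import Data.List.Relation.Unary.Unique.Propositional using (Unique)
open import Data.Product using (_×_)
open import Data.Sum using (_⊎_)
open import Relation.Binary.PropositionalEquality using (_≡_)
open import Relation.Nullary using (¬_)

-- Ground set X = Fin (n₁ + n₂); X₁ = the first n₁ elements, X₂ = the last n₂.
-- Traces of F ⊆ X on X₁ and X₂.
tr₁ : ∀ {n₁ n₂} → Subset (n₁ + n₂) → Subset n₁
tr₁ {n₁} F = take n₁ F

tr₂ : ∀ {n₁ n₂} → Subset (n₁ + n₂) → Subset n₂
tr₂ {n₁} F = drop n₁ F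

Disjoint : ∀ {m} → Subset m → Subset m → Set
Disjoint A B = Empty (A ∩ B)

Comparable : ∀ {m} → Subset m → Subset m → Set
Comparable A B = (A ⊆ B) ⊎ (B ⊆ A)

BadPair : ∀ {n₁ n₂} → Subset (n₁ + n₂) → Subset (n₁ + n₂) → Set
BadPair {n₁} {n₂} F G =
  (Disjoint (tr₁ {n₁} {n₂} F) (tr₁ {n₁} {n₂} G) × Comparable (tr₂ {n₁} {n₂} F) (tr₂ {n₁} {n₂} G))
  ⊎ (Disjoint (tr₂ {n₁} {n₂} F) (tr₂ {n₁} {n₂} G) × Comparable (tr₁ {n₁} {n₂} F) (tr₁ {n₁} {n₂} G))

-- A set system 𝓕 ⊆ 2^X is represented by a duplicate-free list of subsets.
-- 1-part intersecting, 1-part Sperner: no distinct F, G ∈ 𝓕 form a bad pair.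
OnePartIntSperner : ∀ {n₁ n₂} → List (Subset (n₁ + n₂)) → Set
OnePartIntSperner {n₁} {n₂} 𝓕 =
  ∀ {F G} → F ∈ 𝓕 → G ∈ 𝓕 → ¬ (F ≡ G) → ¬ BadPair {n₁} {n₂} F G

IsSystem : ∀ {n₁ n₂} → List (Subset (n₁ + n₂)) → Set
IsSystem {n₁} {n₂} 𝓕 = Unique 𝓕 × OnePartIntSperner {n₁} {n₂} 𝓕

-- Split every F ∈ 𝓕 as A ∪ B with A ⊆ X₁, B ⊆ X₂ and pair the fibre 𝓟 = {B : A ∪ B ∈ 𝓕}
-- with the fibre 𝓠 of the complement X₁ ∖ A.  Both fibres are intersecting, and no member of
-- 𝓟 is comparable with a member of 𝓠 (their X₁-traces A and X₁ ∖ A are disjoint).  For such a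
-- pair |𝓟| + |𝓠| ≤ 2^(|X₂|-1): the up-closures U ⊇ 𝓟 and W ⊇ 𝓠 contain no complementary pair,
-- so |U|, |W| ≤ 2^(|X₂|-1); 𝓟 and 𝓠 avoid U ∩ W; and the Harris–Kleitman inequality
-- |U||W| ≤ 2^|X₂| |U ∩ W| forces |𝓟| + |𝓠| ≤ |U| + |W| - 2|U ∩ W| ≤ 2^(|X₂|-1).  Summing over
-- the 2^(|X₁|-1) pairs {A, X₁ ∖ A} gives |𝓕| ≤ 2^(|X|-2).  Conversely, all sets containing a
-- fixed point of X₁ and a fixed point of X₂ form such a system of that size.
module Submission where

open import Data.Bool using (Bool; true; false; T; _∧_)
open import Data.Bool.Properties using (T-∧) renaming (_≟_ to _≟ᵇ_)
open import Data.Empty using (⊥; ⊥-elim)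
open import Data.Fin using (zero)
open import Data.Fin.Subset using (Subset; inside; outside; _⊆_; ∁; Empty) renaming (⊥ to ∅)
open import Data.Fin.Subset.Properties
  using (⊆-refl; ⊆-trans; ⊆-min; _⊆?_; s⊆s; out⊆; ∉⊥; x∈p∩q⁻; x∈p⇒x∉∁p; Empty-unique; ∩-idem; anySubset?)
open import Data.List using (List; []; _∷_; length; map) renaming (_++_ to _++ᴸ_)
open import Data.List.Membership.Propositional using () renaming (_∈_ to _∈ᴸ_)
open import Data.List.Membership.Propositional.Properties using (∈-map⁻)
open import Data.List.Properties using (length-++; length-map)
open import Data.List.Relation.Unary.All using ([])
open import Data.List.Relation.Unary.All.Properties using (All¬⇒¬Any)
open import Data.List.Relation.Unary.AllPairs using ([]; _∷_)
open import Data.List.Relation.Unary.Any using (here; there; any?)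
open import Data.List.Relation.Unary.Unique.Propositional using (Unique)
open import Data.List.Relation.Unary.Unique.Propositional.Properties using (map⁺; ++⁺)
open import Data.Nat using (ℕ; zero; suc; _+_; _*_; _∸_; _^_; _≤_; _≥_; z≤n; NonZero)
open import Data.Nat.Properties
open import Algebra.Properties.CommutativeSemigroup +-commutativeSemigroup using (interchange)
open import Data.Nat.Tactic.RingSolver using (solve-∀)
open import Data.Product using (∃-syntax; _×_; _,_; proj₁; proj₂)
open import Data.Sum using (_⊎_; inj₁; inj₂; swap)
open import Data.Vec using (Vec; []; _∷_; _++_; take; drop; here)
open import Data.Vec.Properties using (≡-dec; take++drop≡id; ++-injectiveˡ; ++-injectiveʳ; ++-injective; ∷-injectiveʳ)
open import Function using (_∘_; const; id)
open import Function.Bundles using (Equivalence)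
open import Relation.Binary.PropositionalEquality
open import Relation.Nullary using (Dec; does; _because_; ¬_; yes; no)
open import Relation.Nullary.Reflects using (invert)
open import Relation.Nullary.Decidable using (T?; _×-dec_)

open import Defs

_≟ˢ_ : ∀ {m} (s t : Subset m) → Dec (s ≡ t)
_≟ˢ_ = ≡-dec _≟ᵇ_

does⁺ : ∀ {A : Set} (a? : Dec A) → A → T (does a?)
does⁺ (true  because _)   _ = _
does⁺ (false because ¬a) a = invert ¬a a

does⁻ : ∀ {A : Set} (a? : Dec A) → T (does a?) → A
does⁻ (true because a) _ = invert a

chebyshev-sum : ∀ {m n o p} → m ≤ n → o ≤ p → (m + n) * (o + p) ≤ 2 * (m * o + n * p)
chebyshev-sum {m} {_} {o} m≤n o≤p with m≤n⇒∃[o]m+o≡n m≤n | m≤n⇒∃[o]m+o≡n o≤p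
... | d , refl | e , refl = begin
  (m + (m + d)) * (o + (o + e))         ≤⟨ m≤m+n _ (d * e) ⟩
  (m + (m + d)) * (o + (o + e)) + d * e ≡⟨ expand m o d e ⟩
  2 * (m * o + (m + d) * (o + e))       ∎
  where
  open ≤-Reasoning
  expand : ∀ m o d e → (m + (m + d)) * (o + (o + e)) + d * e ≡ 2 * (m * o + (m + d) * (o + e))
  expand = solve-∀

m≤o⇒n≤o⇒o*[m+n]≤o*o+m*n : ∀ {m n o} → m ≤ o → n ≤ o → o * (m + n) ≤ o * o + m * n
-- The slack d * e below is (o ∸ m) * (o ∸ n).
m≤o⇒n≤o⇒o*[m+n]≤o*o+m*n {m} {n} {o} m≤o n≤o with m≤n⇒∃[o]m+o≡n m≤o | m≤n⇒∃[o]m+o≡n n≤o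
... | d , m+d≡o | e , n+e≡o = begin
  o * (m + n)                        ≤⟨ m≤m+n _ (d * e) ⟩
  o * (m + n) + d * e                ≡⟨ cong (_+ d * e) (*-distribˡ-+ o m n) ⟩
  o * m + o * n + d * e              ≡⟨ cong₂ (λ k l → k * m + l * n + d * e) n+e≡o m+d≡o ⟨
  (n + e) * m + (m + d) * n + d * e  ≡⟨ expand m n d e ⟩
  (m + d) * (n + e) + m * n          ≡⟨ cong₂ (λ k l → k * l + m * n) m+d≡o n+e≡o ⟩
  o * o + m * n                      ∎
  where
  open ≤-Reasoning
  expand : ∀ m n d e → (n + e) * m + (m + d) * n + d * e ≡ (m + d) * (n + e) + m * n
  expand = solve-∀

m≤o⇒n≤o⇒m*n≤2*o*p⇒m+n≤o+2*p : ∀ {m n o p} .{{_ : NonZero o}} → m ≤ o → n ≤ o →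
                                m * n ≤ 2 * o * p → m + n ≤ o + 2 * p
m≤o⇒n≤o⇒m*n≤2*o*p⇒m+n≤o+2*p {m} {n} {o} {p} m≤o n≤o mn≤2op = *-cancelˡ-≤ o (begin
  o * (m + n)          ≤⟨ m≤o⇒n≤o⇒o*[m+n]≤o*o+m*n m≤o n≤o ⟩
  o * o + m * n        ≤⟨ +-monoʳ-≤ (o * o) mn≤2op ⟩
  o * o + 2 * o * p    ≡⟨ factor o p ⟩
  o * (o + 2 * p)      ∎)
  where
  open ≤-Reasoning
  factor : ∀ o p → o * o + 2 * o * p ≡ o * (o + 2 * p)
  factor = solve-∀

∑ : ∀ m → (Subset m → ℕ) → ℕ
∑ zero    f = f []
∑ (suc m) f = ∑ m (f ∘ (outside ∷_)) + ∑ m (f ∘ (inside ∷_))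

∑-mono : ∀ m {f g : Subset m → ℕ} → (∀ s → f s ≤ g s) → ∑ m f ≤ ∑ m g
∑-mono zero    f≤g = f≤g []
∑-mono (suc m) f≤g = +-mono-≤ (∑-mono m (f≤g ∘ (outside ∷_))) (∑-mono m (f≤g ∘ (inside ∷_)))

∑-distrib-+ : ∀ m (f g : Subset m → ℕ) → ∑ m (λ s → f s + g s) ≡ ∑ m f + ∑ m g
∑-distrib-+ zero    f g = refl
∑-distrib-+ (suc m) f g =
  trans (cong₂ _+_ (∑-distrib-+ m (f ∘ (outside ∷_)) (g ∘ (outside ∷_)))
                    (∑-distrib-+ m (f ∘ (inside ∷_)) (g ∘ (inside ∷_))))
        (interchange (∑ m (f ∘ (outside ∷_))) (∑ m (g ∘ (outside ∷_)))
                     (∑ m (f ∘ (inside ∷_))) (∑ m (g ∘ (inside ∷_))))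

∑-const : ∀ m c → ∑ m (const c) ≡ 2 ^ m * c
∑-const zero    c = sym (+-identityʳ c)
∑-const (suc m) c = begin
  ∑ m (const c) + ∑ m (const c) ≡⟨ cong₂ _+_ (∑-const m c) (∑-const m c) ⟩
  2 ^ m * c + 2 ^ m * c         ≡⟨ cong (2 ^ m * c +_) (sym (+-identityʳ _)) ⟩
  2 * (2 ^ m * c)               ≡⟨ *-assoc 2 (2 ^ m) c ⟨
  2 ^ suc m * c                 ∎
  where open ≡-Reasoning

∑-∁ : ∀ m (f : Subset m → ℕ) → ∑ m (f ∘ ∁) ≡ ∑ m f
∑-∁ zero    f = refl
∑-∁ (suc m) f = trans (cong₂ _+_ (∑-∁ m (f ∘ (inside ∷_))) (∑-∁ m (f ∘ (outside ∷_))))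
                      (+-comm (∑ m (f ∘ (inside ∷_))) (∑ m (f ∘ (outside ∷_))))

∑-++ : ∀ m n (f : Subset (m + n) → ℕ) → ∑ (m + n) f ≡ ∑ m (λ A → ∑ n (λ B → f (A ++ B)))
∑-++ zero    n f = refl
∑-++ (suc m) n f = cong₂ _+_ (∑-++ m n _) (∑-++ m n _)

∑-∁-pairs : ∀ m {f : Subset (suc m) → ℕ} {h} → (∀ s → f s + f (∁ s) ≤ h) → ∑ (suc m) f ≤ 2 ^ m * h
∑-∁-pairs m {f} {h} pair≤h = *-cancelˡ-≤ 2 (begin
  2 * ∑ (suc m) f                       ≡⟨ cong (∑ (suc m) f +_) (trans (+-identityʳ _) (sym (∑-∁ (suc m) f))) ⟩
  ∑ (suc m) f + ∑ (suc m) (f ∘ ∁)       ≡⟨ ∑-distrib-+ (suc m) f (f ∘ ∁) ⟨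
  ∑ (suc m) (λ s → f s + f (∁ s))       ≤⟨ ∑-mono (suc m) pair≤h ⟩
  ∑ (suc m) (const h)                   ≡⟨ ∑-const (suc m) h ⟩
  2 ^ suc m * h                         ≡⟨ *-assoc 2 (2 ^ m) h ⟩
  2 * (2 ^ m * h)                       ∎)
  where open ≤-Reasoning

Family : ℕ → Set
Family m = Subset m → Bool

_∈ᶠ_ : ∀ {m} → Subset m → Family m → Set
s ∈ᶠ 𝓐 = T (𝓐 s)

_⊆ᶠ_ : ∀ {m} → Family m → Family m → Set
𝓐 ⊆ᶠ 𝓑 = ∀ {s} → s ∈ᶠ 𝓐 → s ∈ᶠ 𝓑

_∩ᶠ_ : ∀ {m} → Family m → Family m → Family m
(𝓐 ∩ᶠ 𝓑) s = 𝓐 s ∧ 𝓑 s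

∩ᶠ⁻ : ∀ {m} {𝓐 𝓑 : Family m} {s} → s ∈ᶠ (𝓐 ∩ᶠ 𝓑) → s ∈ᶠ 𝓐 × s ∈ᶠ 𝓑
∩ᶠ⁻ = Equivalence.to T-∧

∅ᶠ : ∀ {m} → Family m
∅ᶠ _ = false

｛_｝ : ∀ {m} → Subset m → Family m
｛ x ｝ s = does (s ≟ˢ x)

⟦_⟧ : ∀ {m} → List (Subset m) → Family m
⟦ xs ⟧ s = does (any? (s ≟ˢ_) xs)

𝟙 : Bool → ℕ
𝟙 true  = 1
𝟙 false = 0

∣_∣ : ∀ {m} → Family m → ℕ
∣_∣ {m} 𝓐 = ∑ m (𝟙 ∘ 𝓐)

𝟙-mono : ∀ {a b} → (T a → T b) → 𝟙 a ≤ 𝟙 b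
𝟙-mono {false}         _   = z≤n
𝟙-mono {true}  {true}  _   = ≤-refl
𝟙-mono {true}  {false} a⇒b = ⊥-elim (a⇒b _)

𝟙-+-disjoint : ∀ {a b c} → (T a → T c) → (T b → T c) → (T a → T b → ⊥) → 𝟙 a + 𝟙 b ≤ 𝟙 c
𝟙-+-disjoint {false}         _   b⇒c _ = 𝟙-mono b⇒c
𝟙-+-disjoint {true}  {false} a⇒c _   _ = 𝟙-mono a⇒c
𝟙-+-disjoint {true}  {true}  _   _   ¬a∧b = ⊥-elim (¬a∧b _ _)

∣∣-mono : ∀ {m} {𝓐 𝓑 : Family m} → 𝓐 ⊆ᶠ 𝓑 → ∣ 𝓐 ∣ ≤ ∣ 𝓑 ∣
∣∣-mono {m} 𝓐⊆𝓑 = ∑-mono m (λ s → 𝟙-mono (𝓐⊆𝓑 {s}))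

∣∣-+-disjoint : ∀ {m} {𝓐 𝓑 𝓒 : Family m} → 𝓐 ⊆ᶠ 𝓒 → 𝓑 ⊆ᶠ 𝓒 → (∀ {s} → s ∈ᶠ 𝓐 → s ∈ᶠ 𝓑 → ⊥) →
                ∣ 𝓐 ∣ + ∣ 𝓑 ∣ ≤ ∣ 𝓒 ∣
∣∣-+-disjoint {m} {𝓐} {𝓑} {𝓒} 𝓐⊆𝓒 𝓑⊆𝓒 𝓐∩𝓑=∅ = begin
  ∣ 𝓐 ∣ + ∣ 𝓑 ∣                       ≡⟨ ∑-distrib-+ m (𝟙 ∘ 𝓐) (𝟙 ∘ 𝓑) ⟨
  ∑ m (λ s → 𝟙 (𝓐 s) + 𝟙 (𝓑 s))       ≤⟨ ∑-mono m (λ s → 𝟙-+-disjoint (𝓐⊆𝓒 {s}) 𝓑⊆𝓒 𝓐∩𝓑=∅) ⟩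
  ∣ 𝓒 ∣                               ∎
  where open ≤-Reasoning

∣∣≤-∁-free : ∀ {b} {𝓐 : Family (suc b)} → (∀ {s} → s ∈ᶠ 𝓐 → ∁ s ∈ᶠ 𝓐 → ⊥) → ∣ 𝓐 ∣ ≤ 2 ^ b
∣∣≤-∁-free {b} {𝓐} 𝓐-∁-free = ≤-trans
  (∑-∁-pairs b {𝟙 ∘ 𝓐} (λ s → 𝟙-+-disjoint {𝓐 s} {𝓐 (∁ s)} {true} _ _ 𝓐-∁-free))
  (≤-reflexive (*-identityʳ (2 ^ b)))

∣∅ᶠ∣≡0 : ∀ m → ∣ ∅ᶠ {m} ∣ ≡ 0
∣∅ᶠ∣≡0 m = trans (∑-const m 0) (*-zeroʳ (2 ^ m))

∣｛x｝∣≡1 : ∀ {m} (x : Subset m) → ∣ ｛ x ｝ ∣ ≡ 1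
∣｛x｝∣≡1                 []            = refl
∣｛x｝∣≡1 {suc m} (inside  ∷ x) = cong₂ _+_ (∣∅ᶠ∣≡0 m) (∣｛x｝∣≡1 x)
∣｛x｝∣≡1 {suc m} (outside ∷ x) = cong₂ _+_ (∣｛x｝∣≡1 x) (∣∅ᶠ∣≡0 m)

length≤∣⟦⟧∣ : ∀ {m} {xs : List (Subset m)} → Unique xs → length xs ≤ ∣ ⟦ xs ⟧ ∣
length≤∣⟦⟧∣ []                      = z≤n
length≤∣⟦⟧∣ {xs = x ∷ xs} (x∉xs ∷ xs-unique) = begin
  suc (length xs)          ≡⟨ cong (_+ length xs) (∣｛x｝∣≡1 x) ⟨
  ∣ ｛ x ｝ ∣ + length xs    ≤⟨ +-monoʳ-≤ ∣ ｛ x ｝ ∣ (length≤∣⟦⟧∣ xs-unique) ⟩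
  ∣ ｛ x ｝ ∣ + ∣ ⟦ xs ⟧ ∣   ≤⟨ ∣∣-+-disjoint {𝓐 = ｛ x ｝} {⟦ xs ⟧} {⟦ x ∷ xs ⟧} x⇒ xs⇒ disjoint ⟩
  ∣ ⟦ x ∷ xs ⟧ ∣           ∎
  where
  open ≤-Reasoning
  x⇒ : ｛ x ｝ ⊆ᶠ ⟦ x ∷ xs ⟧
  x⇒ {s} s≡x = does⁺ (any? (s ≟ˢ_) (x ∷ xs)) (here (does⁻ (s ≟ˢ x) s≡x))
  xs⇒ : ⟦ xs ⟧ ⊆ᶠ ⟦ x ∷ xs ⟧
  xs⇒ {s} s∈xs = does⁺ (any? (s ≟ˢ_) (x ∷ xs)) (there (does⁻ (any? (s ≟ˢ_) xs) s∈xs))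
  disjoint : ∀ {s} → s ∈ᶠ ｛ x ｝ → s ∈ᶠ ⟦ xs ⟧ → ⊥
  disjoint {s} s≡x s∈xs with does⁻ (s ≟ˢ x) s≡x
  ... | refl = All¬⇒¬Any x∉xs (does⁻ (any? (s ≟ˢ_) xs) s∈xs)

-- Up-closed families and the Harris–Kleitman inequality

UpClosed : ∀ {m} → Family m → Set
UpClosed 𝓐 = ∀ {s t} → s ⊆ t → s ∈ᶠ 𝓐 → t ∈ᶠ 𝓐

↑ : ∀ {m} → Family m → Family m
↑ 𝓐 t = does (anySubset? {P = λ s → s ∈ᶠ 𝓐 × s ⊆ t} (λ s → T? (𝓐 s) ×-dec s ⊆? t))

↑⁺ : ∀ {m} {𝓐 : Family m} {s t} → s ∈ᶠ 𝓐 → s ⊆ t → t ∈ᶠ ↑ 𝓐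
↑⁺ {𝓐 = 𝓐} {s} {t} s∈𝓐 s⊆t = does⁺ (anySubset? (λ s → T? (𝓐 s) ×-dec s ⊆? t)) (s , s∈𝓐 , s⊆t)

↑⁻ : ∀ {m} {𝓐 : Family m} {t} → t ∈ᶠ ↑ 𝓐 → ∃[ s ] s ∈ᶠ 𝓐 × s ⊆ t
↑⁻ {𝓐 = 𝓐} {t} = does⁻ (anySubset? (λ s → T? (𝓐 s) ×-dec s ⊆? t))

⊆ᶠ↑ : ∀ {m} {𝓐 : Family m} → 𝓐 ⊆ᶠ ↑ 𝓐
⊆ᶠ↑ {𝓐 = 𝓐} s∈𝓐 = ↑⁺ {𝓐 = 𝓐} s∈𝓐 ⊆-refl

↑-upClosed : ∀ {m} {𝓐 : Family m} → UpClosed (↑ 𝓐)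
↑-upClosed {𝓐 = 𝓐} t⊆u t∈↑𝓐 with ↑⁻ {𝓐 = 𝓐} t∈↑𝓐
... | s , s∈𝓐 , s⊆t = ↑⁺ {𝓐 = 𝓐} s∈𝓐 (⊆-trans s⊆t t⊆u)

harris-kleitman : ∀ m {𝓤 𝓦 : Family m} → UpClosed 𝓤 → UpClosed 𝓦 →
                  ∣ 𝓤 ∣ * ∣ 𝓦 ∣ ≤ 2 ^ m * ∣ 𝓤 ∩ᶠ 𝓦 ∣
harris-kleitman zero {𝓤} {𝓦} _ _ with 𝓤 [] | 𝓦 []
... | true  | true  = ≤-refl
... | true  | false = z≤n
... | false | _     = z≤n
harris-kleitman (suc m) {𝓤} {𝓦} 𝓤↑ 𝓦↑ = begin
  (u₀ + u₁) * (w₀ + w₁)                ≤⟨ chebyshev-sum (out≤in 𝓤↑) (out≤in 𝓦↑) ⟩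
  2 * (u₀ * w₀ + u₁ * w₁)              ≤⟨ *-monoʳ-≤ 2 (+-mono-≤ (restrict outside) (restrict inside)) ⟩
  2 * (2 ^ m * i₀ + 2 ^ m * i₁)        ≡⟨ cong (2 *_) (*-distribˡ-+ (2 ^ m) i₀ i₁) ⟨
  2 * (2 ^ m * (i₀ + i₁))              ≡⟨ *-assoc 2 (2 ^ m) (i₀ + i₁) ⟨
  2 ^ suc m * (i₀ + i₁)                ∎
  where
  open ≤-Reasoning
  u₀ = ∣ 𝓤 ∘ (outside ∷_) ∣
  u₁ = ∣ 𝓤 ∘ (inside ∷_) ∣
  w₀ = ∣ 𝓦 ∘ (outside ∷_) ∣
  w₁ = ∣ 𝓦 ∘ (inside ∷_) ∣
  i₀ = ∣ (𝓤 ∩ᶠ 𝓦) ∘ (outside ∷_) ∣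
  i₁ = ∣ (𝓤 ∩ᶠ 𝓦) ∘ (inside ∷_) ∣
  out≤in : ∀ {𝓐 : Family (suc m)} → UpClosed 𝓐 → ∣ 𝓐 ∘ (outside ∷_) ∣ ≤ ∣ 𝓐 ∘ (inside ∷_) ∣
  out≤in {𝓐} 𝓐↑ = ∣∣-mono {𝓐 = 𝓐 ∘ (outside ∷_)} {𝓐 ∘ (inside ∷_)} (𝓐↑ (out⊆ ⊆-refl))
  restrict : ∀ x → ∣ 𝓤 ∘ (x ∷_) ∣ * ∣ 𝓦 ∘ (x ∷_) ∣ ≤ 2 ^ m * ∣ (𝓤 ∩ᶠ 𝓦) ∘ (x ∷_) ∣
  restrict x = harris-kleitman m (𝓤↑ ∘ s⊆s) (𝓦↑ ∘ s⊆s)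

-- Only distinct members have to meet, so {∅} is intersecting.
Intersecting : ∀ {m} → Family m → Set
Intersecting 𝓐 = ∀ {B B'} → B ∈ᶠ 𝓐 → B' ∈ᶠ 𝓐 → B ≢ B' → ¬ Disjoint B B'

CrossIncomparable : ∀ {m} → Family m → Family m → Set
CrossIncomparable 𝓐 𝓑 = ∀ {B B'} → B ∈ᶠ 𝓐 → B' ∈ᶠ 𝓑 → ¬ Comparable B B'

CrossIncomparable-sym : ∀ {m} {𝓐 𝓑 : Family m} → CrossIncomparable 𝓐 𝓑 → CrossIncomparable 𝓑 𝓐
CrossIncomparable-sym 𝓐𝓑-inc B∈𝓑 B'∈𝓐 = 𝓐𝓑-inc B'∈𝓐 B∈𝓑 ∘ swap

∅-Disjoint : ∀ {m} (B : Subset m) → Disjoint ∅ B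
∅-Disjoint B (_ , x∈∅∩B) = ∉⊥ (proj₁ (x∈p∩q⁻ ∅ B x∈∅∩B))

⊆∁⇒Disjoint : ∀ {m} {B B' s : Subset m} → B ⊆ s → B' ⊆ ∁ s → Disjoint B B'
⊆∁⇒Disjoint {B = B} {B'} B⊆s B'⊆∁s (_ , x∈B∩B') with x∈p∩q⁻ B B' x∈B∩B'
... | x∈B , x∈B' = x∈p⇒x∉∁p (B⊆s x∈B) (B'⊆∁s x∈B')

↑-∁-free : ∀ {m} {𝓐 : Family m} → Intersecting 𝓐 → ¬ ∅ ∈ᶠ 𝓐 → ∀ {s} → s ∈ᶠ ↑ 𝓐 → ∁ s ∈ᶠ ↑ 𝓐 → ⊥
↑-∁-free {𝓐 = 𝓐} 𝓐-int ∅∉𝓐 s∈↑𝓐 ∁s∈↑𝓐 with ↑⁻ {𝓐 = 𝓐} s∈↑𝓐 | ↑⁻ {𝓐 = 𝓐} ∁s∈↑𝓐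
... | B , B∈𝓐 , B⊆s | B' , B'∈𝓐 , B'⊆∁s with B ≟ˢ B' | ⊆∁⇒Disjoint B⊆s B'⊆∁s
...   | no B≢B' | B∩B'=∅ = 𝓐-int B∈𝓐 B'∈𝓐 B≢B' B∩B'=∅
...   | yes refl | B∩B=∅ = ∅∉𝓐 (subst (_∈ᶠ 𝓐) (Empty-unique (subst Empty (∩-idem B) B∩B=∅)) B∈𝓐)

↑-avoids : ∀ {m} {𝓟 𝓠 : Family m} → CrossIncomparable 𝓟 𝓠 → ∀ {s} → s ∈ᶠ 𝓟 → s ∈ᶠ ↑ 𝓠 → ⊥
↑-avoids {𝓟 = 𝓟} {𝓠} 𝓟𝓠-inc s∈𝓟 s∈↑𝓠 with ↑⁻ {𝓐 = 𝓠} s∈↑𝓠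
... | B , B∈𝓠 , B⊆s = 𝓟𝓠-inc s∈𝓟 B∈𝓠 (inj₂ B⊆s)

∅∈⇒∣∣+∣∣≤1 : ∀ {m} {𝓟 𝓠 : Family m} → Intersecting 𝓟 → CrossIncomparable 𝓟 𝓠 → ∅ ∈ᶠ 𝓟 →
             ∣ 𝓟 ∣ + ∣ 𝓠 ∣ ≤ 1
∅∈⇒∣∣+∣∣≤1 {m} {𝓟} {𝓠} 𝓟-int 𝓟𝓠-inc ∅∈𝓟 = begin
  ∣ 𝓟 ∣ + ∣ 𝓠 ∣          ≤⟨ +-mono-≤ (∣∣-mono {𝓐 = 𝓟} {｛ ∅ {m} ｝} 𝓟⊆｛∅｝)
                                     (∣∣-mono {𝓐 = 𝓠} {∅ᶠ} 𝓠⊆∅ᶠ) ⟩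
  ∣ ｛ ∅ {m} ｝ ∣ + ∣ ∅ᶠ {m} ∣ ≡⟨ cong₂ _+_ (∣｛x｝∣≡1 (∅ {m})) (∣∅ᶠ∣≡0 m) ⟩
  1                      ∎
  where
  open ≤-Reasoning
  𝓟⊆｛∅｝ : 𝓟 ⊆ᶠ ｛ ∅ ｝
  𝓟⊆｛∅｝ {s} s∈𝓟 with s ≟ˢ ∅
  ... | yes _   = _
  ... | no s≢∅ = 𝓟-int ∅∈𝓟 s∈𝓟 (s≢∅ ∘ sym) (∅-Disjoint s)
  𝓠⊆∅ᶠ : 𝓠 ⊆ᶠ ∅ᶠ
  𝓠⊆∅ᶠ s∈𝓠 = 𝓟𝓠-inc ∅∈𝓟 s∈𝓠 (inj₁ (⊆-min _))

∅∉⇒∣∣+∣∣≤2^b : ∀ {b} {𝓟 𝓠 : Family (suc b)} → Intersecting 𝓟 → Intersecting 𝓠 →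
               CrossIncomparable 𝓟 𝓠 → ¬ ∅ ∈ᶠ 𝓟 → ¬ ∅ ∈ᶠ 𝓠 → ∣ 𝓟 ∣ + ∣ 𝓠 ∣ ≤ 2 ^ b
∅∉⇒∣∣+∣∣≤2^b {b} {𝓟} {𝓠} 𝓟-int 𝓠-int 𝓟𝓠-inc ∅∉𝓟 ∅∉𝓠 = +-cancelʳ-≤ (2 * i) _ _ (begin
  ∣ 𝓟 ∣ + ∣ 𝓠 ∣ + 2 * i        ≡⟨ shuffle ∣ 𝓟 ∣ ∣ 𝓠 ∣ i ⟩
  (∣ 𝓟 ∣ + i) + (∣ 𝓠 ∣ + i)    ≤⟨ +-mono-≤ 𝓟-part 𝓠-part ⟩
  ∣ ↑ 𝓟 ∣ + ∣ ↑ 𝓠 ∣            ≤⟨ m≤o⇒n≤o⇒m*n≤2*o*p⇒m+n≤o+2*p {{m^n≢0 2 b}}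
                                     (∣∣≤-∁-free {𝓐 = ↑ 𝓟} (↑-∁-free {𝓐 = 𝓟} 𝓟-int ∅∉𝓟))
                                     (∣∣≤-∁-free {𝓐 = ↑ 𝓠} (↑-∁-free {𝓐 = 𝓠} 𝓠-int ∅∉𝓠))
                                     (harris-kleitman (suc b) (↑-upClosed {𝓐 = 𝓟}) (↑-upClosed {𝓐 = 𝓠})) ⟩
  2 ^ b + 2 * i                ∎)
  where
  open ≤-Reasoning
  i = ∣ ↑ 𝓟 ∩ᶠ ↑ 𝓠 ∣
  shuffle : ∀ p q i → p + q + 2 * i ≡ (p + i) + (q + i)
  shuffle = solve-∀
  𝓟-part : ∣ 𝓟 ∣ + i ≤ ∣ ↑ 𝓟 ∣
  𝓟-part = ∣∣-+-disjoint {𝓐 = 𝓟} {↑ 𝓟 ∩ᶠ ↑ 𝓠} {↑ 𝓟} (⊆ᶠ↑ {𝓐 = 𝓟}) (proj₁ ∘ ∩ᶠ⁻ {𝓐 = ↑ 𝓟} {↑ 𝓠})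
             (λ s∈𝓟 s∈∩ → ↑-avoids {𝓟 = 𝓟} {𝓠} 𝓟𝓠-inc s∈𝓟 (proj₂ (∩ᶠ⁻ {𝓐 = ↑ 𝓟} {↑ 𝓠} s∈∩)))
  𝓠-part : ∣ 𝓠 ∣ + i ≤ ∣ ↑ 𝓠 ∣
  𝓠-part = ∣∣-+-disjoint {𝓐 = 𝓠} {↑ 𝓟 ∩ᶠ ↑ 𝓠} {↑ 𝓠} (⊆ᶠ↑ {𝓐 = 𝓠}) (proj₂ ∘ ∩ᶠ⁻ {𝓐 = ↑ 𝓟} {↑ 𝓠})
             (λ s∈𝓠 s∈∩ → ↑-avoids {𝓟 = 𝓠} {𝓟} (CrossIncomparable-sym {𝓐 = 𝓟} {𝓠} 𝓟𝓠-inc) s∈𝓠 (proj₁ (∩ᶠ⁻ {𝓐 = ↑ 𝓟} {↑ 𝓠} s∈∩)))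

cross-intersecting-bound : ∀ {b} {𝓟 𝓠 : Family (suc b)} → Intersecting 𝓟 → Intersecting 𝓠 →
                           CrossIncomparable 𝓟 𝓠 → ∣ 𝓟 ∣ + ∣ 𝓠 ∣ ≤ 2 ^ b
cross-intersecting-bound {b} {𝓟} {𝓠} 𝓟-int 𝓠-int 𝓟𝓠-inc with T? (𝓟 ∅) | T? (𝓠 ∅)
... | yes ∅∈𝓟 | _       = ≤-trans (∅∈⇒∣∣+∣∣≤1 {𝓠 = 𝓠} 𝓟-int 𝓟𝓠-inc ∅∈𝓟) (m^n>0 2 b)
... | no ∅∉𝓟 | yes ∅∈𝓠 = begin
  ∣ 𝓟 ∣ + ∣ 𝓠 ∣ ≡⟨ +-comm ∣ 𝓟 ∣ ∣ 𝓠 ∣ ⟩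
  ∣ 𝓠 ∣ + ∣ 𝓟 ∣ ≤⟨ ∅∈⇒∣∣+∣∣≤1 {𝓠 = 𝓟} 𝓠-int (CrossIncomparable-sym 𝓟𝓠-inc) ∅∈𝓠 ⟩
  1             ≤⟨ m^n>0 2 b ⟩
  2 ^ b         ∎
  where open ≤-Reasoning
... | no ∅∉𝓟 | no ∅∉𝓠  = ∅∉⇒∣∣+∣∣≤2^b 𝓟-int 𝓠-int 𝓟𝓠-inc ∅∉𝓟 ∅∉𝓠

-- The upper bound

take-++ : ∀ {A : Set} {m n} (xs : Vec A m) (ys : Vec A n) → take m (xs ++ ys) ≡ xs
take-++ {m = m} xs ys = ++-injectiveˡ (take m (xs ++ ys)) xs (take++drop≡id m (xs ++ ys))

drop-++ : ∀ {A : Set} {m n} (xs : Vec A m) (ys : Vec A n) → drop m (xs ++ ys) ≡ ys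
drop-++ {m = m} xs ys = ++-injectiveʳ (take m (xs ++ ys)) xs (take++drop≡id m (xs ++ ys))

badPair-++ : ∀ {n₁ n₂} {A A' : Subset n₁} {B B' : Subset n₂} →
             (Disjoint A A' × Comparable B B') ⊎ (Disjoint B B' × Comparable A A') →
             BadPair {n₁} {n₂} (A ++ B) (A' ++ B')
badPair-++ {A = A} {A'} {B} {B'} rewrite take-++ A B | take-++ A' B' | drop-++ A B | drop-++ A' B' = id

Disjoint-∁ : ∀ {m} (A : Subset m) → Disjoint A (∁ A)
Disjoint-∁ A = ⊆∁⇒Disjoint ⊆-refl ⊆-refl

≢∁ : ∀ {m} (A : Subset (suc m)) → A ≢ ∁ A
≢∁ (inside  ∷ _) ()
≢∁ (outside ∷ _) ()

module _ {a b} {𝓕 : List (Subset (suc a + suc b))} (𝓕-sperner : OnePartIntSperner {suc a} {suc b} 𝓕) where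

  fibre : Subset (suc a) → Family (suc b)
  fibre A B = ⟦ 𝓕 ⟧ (A ++ B)

  ∈fibre⁻ : ∀ A B → B ∈ᶠ fibre A → A ++ B ∈ᴸ 𝓕
  ∈fibre⁻ A B = does⁻ (any? ((A ++ B) ≟ˢ_) 𝓕)

  fibre-intersecting : ∀ A → Intersecting (fibre A)
  fibre-intersecting A {B} {B'} B∈ B'∈ B≢B' B∩B'=∅ =
    𝓕-sperner (∈fibre⁻ A B B∈) (∈fibre⁻ A B' B'∈) (B≢B' ∘ ++-injectiveʳ A A)
              (badPair-++ {A = A} {A} (inj₂ (B∩B'=∅ , inj₁ ⊆-refl)))

  fibres-∁-crossIncomparable : ∀ A → CrossIncomparable (fibre A) (fibre (∁ A))
  fibres-∁-crossIncomparable A {B} {B'} B∈ B'∈ B~B' =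
    𝓕-sperner (∈fibre⁻ A B B∈) (∈fibre⁻ (∁ A) B' B'∈) (≢∁ A ∘ ++-injectiveˡ A (∁ A))
              (badPair-++ (inj₁ (Disjoint-∁ A , B~B')))

  upper-bound : Unique 𝓕 → length 𝓕 ≤ 2 ^ (a + b)
  upper-bound 𝓕-unique = begin
    length 𝓕                           ≤⟨ length≤∣⟦⟧∣ 𝓕-unique ⟩
    ∣ ⟦ 𝓕 ⟧ ∣                          ≡⟨ ∑-++ (suc a) (suc b) (𝟙 ∘ ⟦ 𝓕 ⟧) ⟩
    ∑ (suc a) (λ A → ∣ fibre A ∣)      ≤⟨ ∑-∁-pairs a {λ A → ∣ fibre A ∣} fibre-pair-bound ⟩
    2 ^ a * 2 ^ b                      ≡⟨ ^-distribˡ-+-* 2 a b ⟨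
    2 ^ (a + b)                        ∎
    where
    open ≤-Reasoning
    fibre-pair-bound : ∀ A → ∣ fibre A ∣ + ∣ fibre (∁ A) ∣ ≤ 2 ^ b
    fibre-pair-bound A = cross-intersecting-bound {𝓟 = fibre A} {fibre (∁ A)}
      (fibre-intersecting A) (fibre-intersecting (∁ A)) (fibres-∁-crossIncomparable A)

-- The extremal construction

allSubsets : ∀ m → List (Subset m)
allSubsets zero    = [] ∷ []
allSubsets (suc m) = map (outside ∷_) (allSubsets m) ++ᴸ map (inside ∷_) (allSubsets m)

length-allSubsets : ∀ m → length (allSubsets m) ≡ 2 ^ m
length-allSubsets zero    = refl
length-allSubsets (suc m) = begin
  length (map (outside ∷_) (allSubsets m) ++ᴸ map (inside ∷_) (allSubsets m))
    ≡⟨ length-++ (map (outside ∷_) (allSubsets m)) ⟩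
  length (map (outside ∷_) (allSubsets m)) + length (map (inside ∷_) (allSubsets m))
    ≡⟨ cong₂ _+_ (length-map (outside ∷_) (allSubsets m)) (length-map (inside ∷_) (allSubsets m)) ⟩
  length (allSubsets m) + length (allSubsets m)
    ≡⟨ cong₂ _+_ (length-allSubsets m) (trans (length-allSubsets m) (sym (+-identityʳ (2 ^ m)))) ⟩
  2 ^ suc m ∎
  where open ≡-Reasoning

allSubsets-unique : ∀ m → Unique (allSubsets m)
allSubsets-unique zero    = [] ∷ []
allSubsets-unique (suc m) =
  ++⁺ (map⁺ ∷-injectiveʳ (allSubsets-unique m)) (map⁺ ∷-injectiveʳ (allSubsets-unique m)) heads-differ
  where
  heads-differ : ∀ {s} → ¬ (s ∈ᴸ map (outside ∷_) (allSubsets m) × s ∈ᴸ map (inside ∷_) (allSubsets m))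
  heads-differ (s∈₀ , s∈₁) with ∈-map⁻ (outside ∷_) s∈₀ | ∈-map⁻ (inside ∷_) s∈₁
  ... | _ , _ , refl | _ , _ , ()

pin : ∀ a b → Subset (a + b) → Subset (suc a + suc b)
pin a b s = (inside ∷ take a s) ++ (inside ∷ drop a s)

pin-injective : ∀ a b {s t} → pin a b s ≡ pin a b t → s ≡ t
pin-injective a b {s} {t} eq with ++-injective (inside ∷ take a s) (inside ∷ take a t) eq
... | take≡ , drop≡ = begin
  s                     ≡⟨ take++drop≡id a s ⟨
  take a s ++ drop a s  ≡⟨ cong₂ _++_ (∷-injectiveʳ take≡) (∷-injectiveʳ drop≡) ⟩
  take a t ++ drop a t  ≡⟨ take++drop≡id a t ⟩
  t                     ∎
  where open ≡-Reasoning

pinned : ∀ a b → List (Subset (suc a + suc b))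
pinned a b = map (pin a b) (allSubsets (a + b))

pinned-isSystem : ∀ a b → IsSystem {suc a} {suc b} (pinned a b)
pinned-isSystem a b = map⁺ (pin-injective a b) (allSubsets-unique (a + b)) , no-bad-pair
  where
  meet : ∀ {k} {X Y : Subset k} → ¬ Disjoint (inside ∷ X) (inside ∷ Y)
  meet X∩Y=∅ = X∩Y=∅ (zero , here)
  no-bad-pair : OnePartIntSperner {suc a} {suc b} (pinned a b)
  no-bad-pair F∈ G∈ _ bad with ∈-map⁻ (pin a b) F∈ | ∈-map⁻ (pin a b) G∈
  ... | s , _ , refl | t , _ , refl with bad
  ... | inj₁ (tr₁-disjoint , _) =
    meet (subst₂ Disjoint (take-++ (inside ∷ take a s) _) (take-++ (inside ∷ take a t) _) tr₁-disjoint)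
  ... | inj₂ (tr₂-disjoint , _) =
    meet (subst₂ Disjoint (drop-++ (inside ∷ take a s) _) (drop-++ (inside ∷ take a t) _) tr₂-disjoint)

length-pinned : ∀ a b → length (pinned a b) ≡ 2 ^ (a + b)
length-pinned a b = trans (length-map (pin a b) (allSubsets (a + b))) (length-allSubsets (a + b))

theorem4 : (n₁ n₂ : ℕ) → n₁ ≥ 1 → n₂ ≥ 1 →
    (𝓕 : List (Subset (n₁ + n₂))) → IsSystem {n₁} {n₂} 𝓕 →
    (∀ (𝓖 : List (Subset (n₁ + n₂))) → IsSystem {n₁} {n₂} 𝓖 → length 𝓖 ≤ length 𝓕) →
    length 𝓕 ≡ 2 ^ ((n₁ + n₂) ∸ 2)
theorem4 (suc a) (suc b) _ _ 𝓕 (𝓕-unique , 𝓕-sperner) 𝓕-maximum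
  rewrite cong (_∸ 1) (+-suc a b) =
  ≤-antisym (upper-bound 𝓕-sperner 𝓕-unique)
            (subst (_≤ length 𝓕) (length-pinned a b) (𝓕-maximum (pinned a b) (pinned-isSystem a b)))
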